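{- Let $n,q,s\ge1$ with $q\ge s$. If $\mathcal{F}\subseteq\{0,1,\dots,q\}^n$ is $s$-sum intersecting, then $|\mathcal{F}|\le (q+1)^n-s^n+\left\lceil\frac{s^n}{2}\right\rceil$, and this bound is best possible.
   Context: Two vectors $\mathbf{x},\mathbf{y}\in\{0,1,\dots,q\}^n$ are $s$-sum intersecting if there is a coordinate $i$ with $x_i+y_i\ge s$; a family is $s$-sum intersecting if any two distinct members are $s$-sum intersecting. -}

module Defs where

open import Data.Nat using (ℕ; suc; _+_; _≥_)
open import Data.Fin using (Fin; toℕ)
open import Data.Vec using (Vec; lookup)
open import Data.Product using (∃)
open import Data.List using (List)
open import Data.List.Membership.Propositional using (_∈_)
open import Relation.Binary.PropositionalEquality using (_≢_)

Word : ℕ → ℕ → Set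
Word q n = Vec (Fin (suc q)) n

SumIntersecting : {q n : ℕ} → ℕ → Word q n → Word q n → Set
SumIntersecting s x y = ∃ λ i → toℕ (lookup x i) + toℕ (lookup y i) ≥ s

-- A family (a duplicate-free list) is s-sum intersecting if any two
-- distinct members are s-sum intersecting.
SumIntersectingFamily : {q n : ℕ} → ℕ → List (Word q n) → Set
SumIntersectingFamily {q} {n} s F =
  ∀ (x y : Word q n) → x ∈ F → y ∈ F → x ≢ y → SumIntersecting s x y

-- Call a word small if all its letters are < s, and let the complement
-- x̄ of a small word x be given by x̄ᵢ = s − 1 − xᵢ. A word with a letter ≥ s
-- s-sum intersects every word, while a small word never s-sum intersects its
-- complement; so an s-sum intersecting family contains at most one word of each
-- pair {x, x̄}, and replacing every member by the lexicographically larger of x and x̄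
-- injects it into G = {x | not (x small and x <lex x̄)}, a family of size
-- (q + 1)ⁿ − ⌊sⁿ/2⌋. G is itself s-sum intersecting: if small x, y ∈ G do not
-- intersect then y ≤ x̄ and x ≤ ȳ coordinatewise, so y ≤lex x̄ ≤lex x ≤lex ȳ ≤lex y.
module Submission where

open import Defs
open import Data.Bool using (Bool; true; false; not; T; _∧_; if_then_else_)
open import Data.Bool.Properties using (T-∧)
open import Data.Empty using (⊥-elim)
open import Data.Fin using (Fin; zero; suc; toℕ; fromℕ<)
open import Data.Fin.Properties using (toℕ-fromℕ<; toℕ-injective; any?; pigeonhole) renaming (<⇒≢ to <⇒≢ᶠ)
open import Data.List using (List; []; _∷_; _++_; map; length; lookup; tabulate; allFin; filterᵇ; cartesianProductWith)
open import Data.List.Membership.Propositional using (_∈_)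
open import Data.List.Membership.Propositional.Properties using (∈-lookup; ∈-filter⁺; ∈-filter⁻; ∈-allFin; ∈-cartesianProductWith⁺)
open import Data.List.Properties using (length-++; length-map; filter-++; map-cong; map-tabulate; length-tabulate)
open import Data.List.Relation.Unary.All as All using ([])
open import Data.List.Relation.Unary.Any as Any using (here)
open import Data.List.Relation.Unary.Any.Properties using (lookup-index)
open import Data.List.Relation.Unary.AllPairs using ([]; _∷_)
open import Data.List.Relation.Unary.Unique.Propositional using (Unique)
open import Data.List.Relation.Unary.Unique.Propositional.Properties using (cartesianProductWith⁺; allFin⁺; filter⁺)
open import Data.Nat using (ℕ; zero; suc; _+_; _*_; _∸_; _^_; _≤_; _<_; _≥_; _<ᵇ_; s≤s; ⌊_/2⌋; ⌈_/2⌉)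
open import Data.Nat.ListAction using (sum)
open import Data.Nat.Properties
open import Data.Product using (_×_; _,_; proj₂; Σ)
open import Data.Sum using (_⊎_; inj₁; inj₂)
open import Data.Vec using (Vec; []; _∷_) renaming (lookup to lookupᵛ; map to mapᵛ)
open import Data.Vec.Properties using (∷-injective; lookup-map; ≡-dec)
open import Data.Vec.Relation.Unary.All using (All; []; _∷_; all?)
open import Data.Vec.Relation.Unary.All.Properties using (lookup⁺)
open import Function using (_∘_; id)
open import Function.Bundles using (Equivalence)
open import Relation.Binary.PropositionalEquality using (_≡_; _≢_; refl; sym; trans; cong; cong₂; subst)
open import Relation.Nullary using (¬_; Dec; yes; no; contradiction)
open import Relation.Nullary.Decidable using (T?)
open Relation.Binary.PropositionalEquality.≡-Reasoning

private variable
  A B C : Set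

Unique⇒lookup-injective : {xs : List A} → Unique xs → ∀ {i j} → lookup xs i ≡ lookup xs j → i ≡ j
Unique⇒lookup-injective (_ ∷ _) {zero} {zero} _ = refl
Unique⇒lookup-injective (x∉xs ∷ _) {zero} {suc j} eq = ⊥-elim (All.lookup x∉xs (∈-lookup j) eq)
Unique⇒lookup-injective (x∉xs ∷ _) {suc i} {zero} eq = ⊥-elim (All.lookup x∉xs (∈-lookup i) (sym eq))
Unique⇒lookup-injective (_ ∷ u) {suc i} {suc j} eq = cong suc (Unique⇒lookup-injective u eq)

length-≤-injection : (h : A → B) {xs : List A} {ys : List B} → Unique xs →
  (∀ {x y} → x ∈ xs → y ∈ xs → h x ≡ h y → x ≡ y) →
  (∀ {x} → x ∈ xs → h x ∈ ys) → length xs ≤ length ys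
length-≤-injection h {xs} {ys} unique injective into = ≮⇒≥ no-collision
  where
  position : Fin (length xs) → Fin (length ys)
  position i = Any.index (into (∈-lookup i))
  no-collision : ¬ length ys < length xs
  no-collision ys<xs with pigeonhole ys<xs position
  ... | i , j , i<j , same = <⇒≢ᶠ i<j (Unique⇒lookup-injective unique
    (injective (∈-lookup i) (∈-lookup j) (begin
      h (lookup xs i)        ≡⟨ lookup-index (into (∈-lookup i)) ⟩
      lookup ys (position i) ≡⟨ cong (lookup ys) same ⟩
      lookup ys (position j) ≡⟨ lookup-index (into (∈-lookup j)) ⟨
      h (lookup xs j)        ∎)))

count : (A → Bool) → List A → ℕ
count p xs = length (filterᵇ p xs)

module _ (p : A → Bool) where

  count-++ : ∀ xs ys → count p (xs ++ ys) ≡ count p xs + count p ys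
  count-++ xs ys = trans (cong length (filter-++ (T? ∘ p) xs ys)) (length-++ (filterᵇ p xs))

  count-map : (f : B → A) → ∀ xs → count p (map f xs) ≡ count (p ∘ f) xs
  count-map f [] = refl
  count-map f (x ∷ xs) with p (f x)
  ... | true = cong suc (count-map f xs)
  ... | false = count-map f xs

  count+count-not : ∀ xs → count p xs + count (not ∘ p) xs ≡ length xs
  count+count-not [] = refl
  count+count-not (x ∷ xs) with p x
  ... | true = cong suc (count+count-not xs)
  ... | false = trans (+-suc (count p xs) _) (cong suc (count+count-not xs))

count-false : (xs : List A) → count (λ _ → false) xs ≡ 0
count-false [] = refl
count-false (x ∷ xs) = count-false xs

count-if : (b : Bool) (p : A → Bool) → ∀ xs → count (λ x → b ∧ p x) xs ≡ (if b then count p xs else 0)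
count-if true p xs = refl
count-if false p xs = count-false xs

count-cartesianProductWith : (p : C → Bool) (f : A → B → C) → ∀ xs ys →
  count p (cartesianProductWith f xs ys) ≡ sum (map (λ x → count (p ∘ f x) ys) xs)
count-cartesianProductWith p f [] ys = refl
count-cartesianProductWith p f (x ∷ xs) ys = begin
  count p (map (f x) ys ++ cartesianProductWith f xs ys)
    ≡⟨ count-++ p (map (f x) ys) _ ⟩
  count p (map (f x) ys) + count p (cartesianProductWith f xs ys)
    ≡⟨ cong₂ _+_ (count-map p (f x) ys) (count-cartesianProductWith p f xs ys) ⟩
  count (p ∘ f x) ys + sum (map (λ x → count (p ∘ f x) ys) xs) ∎

length-≤-count : (h : A → B) (p : B → Bool) {xs : List A} {ys : List B} → Unique xs →
  (∀ {x y} → x ∈ xs → y ∈ xs → h x ≡ h y → x ≡ y) →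
  (∀ {x} → x ∈ xs → h x ∈ ys) → (∀ {x} → x ∈ xs → T (p (h x))) → length xs ≤ count p ys
length-≤-count h p unique injective into holds =
  length-≤-injection h unique injective (λ x∈xs → ∈-filter⁺ (T? ∘ p) (into x∈xs) (holds x∈xs))

length-cartesianProductWith : (f : A → B → C) → ∀ xs ys →
  length (cartesianProductWith f xs ys) ≡ length xs * length ys
length-cartesianProductWith f [] ys = refl
length-cartesianProductWith f (x ∷ xs) ys = begin
  length (map (f x) ys ++ cartesianProductWith f xs ys)
    ≡⟨ length-++ (map (f x) ys) ⟩
  length (map (f x) ys) + length (cartesianProductWith f xs ys)
    ≡⟨ cong₂ _+_ (length-map (f x) ys) (length-cartesianProductWith f xs ys) ⟩
  length ys + length xs * length ys ∎

vectors : List A → ∀ n → List (Vec A n)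
vectors as zero = [] ∷ []
vectors as (suc n) = cartesianProductWith _∷_ as (vectors as n)

module _ {as : List A} where

  ∈-vectors : (∀ a → a ∈ as) → ∀ {n} (v : Vec A n) → v ∈ vectors as n
  ∈-vectors complete [] = here refl
  ∈-vectors complete (a ∷ v) = ∈-cartesianProductWith⁺ _∷_ (complete a) (∈-vectors complete v)

  vectors-unique : Unique as → ∀ n → Unique (vectors as n)
  vectors-unique unique zero = [] ∷ []
  vectors-unique unique (suc n) = cartesianProductWith⁺ _∷_ ∷-injective unique (vectors-unique unique n)

  length-vectors : ∀ n → length (vectors as n) ≡ length as ^ n
  length-vectors zero = refl
  length-vectors (suc n) =
    trans (length-cartesianProductWith _∷_ as (vectors as n)) (cong (length as *_) (length-vectors n))

  count-vectors-∷ : ∀ {n} (p : Vec A (suc n) → Bool) →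
    count p (vectors as (suc n)) ≡ sum (map (λ a → count (λ v → p (a ∷ v)) (vectors as n)) as)
  count-vectors-∷ {n} p = count-cartesianProductWith p _∷_ as (vectors as n)

sum-tabulate-0 : ∀ m → sum (tabulate {n = m} (λ _ → 0)) ≡ 0
sum-tabulate-0 zero = refl
sum-tabulate-0 (suc m) = sum-tabulate-0 m

sum-tabulate-<ᵇ : ∀ X s m → s ≤ m → sum (tabulate {n = m} (λ a → if toℕ a <ᵇ s then X else 0)) ≡ s * X
sum-tabulate-<ᵇ X zero m _ = sum-tabulate-0 m
sum-tabulate-<ᵇ X (suc s) (suc m) (s≤s s≤m) = cong (X +_) (sum-tabulate-<ᵇ X s m s≤m)

⌊m+m+n/2⌋≡m+⌊n/2⌋ : ∀ m n → ⌊ (m + m) + n /2⌋ ≡ m + ⌊ n /2⌋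
⌊m+m+n/2⌋≡m+⌊n/2⌋ zero n = refl
⌊m+m+n/2⌋≡m+⌊n/2⌋ (suc m) n rewrite +-suc m m = cong suc (⌊m+m+n/2⌋≡m+⌊n/2⌋ m n)

[m∸n]+⌈n/2⌉≡m∸⌊n/2⌋ : ∀ {m n} → n ≤ m → (m ∸ n) + ⌈ n /2⌉ ≡ m ∸ ⌊ n /2⌋
[m∸n]+⌈n/2⌉≡m∸⌊n/2⌋ {m} {n} n≤m = begin
  (m ∸ n) + c             ≡⟨ cong ((m ∸ n) +_) (m+n∸m≡n h c) ⟨
  (m ∸ n) + (h + c ∸ h)   ≡⟨ cong (λ k → (m ∸ n) + (k ∸ h)) (⌊n/2⌋+⌈n/2⌉≡n n) ⟩
  (m ∸ n) + (n ∸ h)       ≡⟨ +-∸-assoc (m ∸ n) (⌊n/2⌋≤n n) ⟨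
  (m ∸ n) + n ∸ h         ≡⟨ cong (_∸ h) (m∸n+n≡m n≤m) ⟩
  m ∸ h                   ∎
  where
  h = ⌊ n /2⌋
  c = ⌈ n /2⌉

data Side : Set where
  lower middle upper : Side

opposite : Side → Side
opposite lower = upper
opposite middle = middle
opposite upper = lower

onSide : {A : Set} → Side → A → A → A → A
onSide lower x y z = x
onSide middle x y z = y
onSide upper x y z = z

-- side a t compares a + a with t, i.e. the letter a with its complement t ∸ a.
side : ℕ → ℕ → Side
side zero zero = middle
side zero (suc t) = lower
side (suc a) zero = upper
side (suc a) (suc zero) = upper
side (suc a) (suc (suc t)) = side a t

t<a⇒side≡upper : ∀ {a t} → t < a → side a t ≡ upper
t<a⇒side≡upper {suc a} {zero} _ = refl
t<a⇒side≡upper {suc a} {suc zero} _ = refl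
t<a⇒side≡upper {suc a} {suc (suc t)} (s≤s t+1<a) = t<a⇒side≡upper (<⇒≤ t+1<a)

side≢upper⇒≤ : ∀ {a t} → side a t ≢ upper → a ≤ t
side≢upper⇒≤ side≢upper = ≮⇒≥ (side≢upper ∘ t<a⇒side≡upper)

side-∸≡opposite : ∀ {a t} → a ≤ t → side (t ∸ a) t ≡ opposite (side a t)
side-∸≡opposite {zero} {zero} _ = refl
side-∸≡opposite {zero} {suc zero} _ = refl
side-∸≡opposite {zero} {suc (suc t)} _ = t<a⇒side≡upper (n<1+n t)
side-∸≡opposite {suc zero} {suc zero} _ = refl
side-∸≡opposite {suc a} {suc (suc t)} (s≤s a≤t+1) with m≤n⇒m<n∨m≡n a≤t+1
... | inj₁ (s≤s a≤t) = trans (cong (λ u → side u (suc (suc t))) (+-∸-assoc 1 a≤t)) (side-∸≡opposite a≤t)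
... | inj₂ refl = begin
  side (t ∸ t) (suc (suc t)) ≡⟨ cong (λ u → side u (suc (suc t))) (n∸n≡0 t) ⟩
  lower                      ≡⟨ cong opposite (t<a⇒side≡upper (n<1+n t)) ⟨
  opposite (side (suc t) t)  ∎

side-+≤ : ∀ {a b t} → a + b ≤ t →
  side a t ≡ lower ⊎ side b t ≡ lower ⊎ (side a t ≡ middle × side b t ≡ middle × a ≡ b)
side-+≤ {zero} {zero} {zero} _ = inj₂ (inj₂ (refl , refl , refl))
side-+≤ {zero} {_} {suc t} _ = inj₁ refl
side-+≤ {suc a} {zero} {suc t} _ = inj₂ (inj₁ refl)
side-+≤ {suc a} {suc b} {suc zero} (s≤s a+b+1≤0) = contradiction (subst (_≤ 0) (+-suc a b) a+b+1≤0) λ ()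
side-+≤ {suc a} {suc b} {suc (suc t)} (s≤s a+b+1≤t+1)
  with side-+≤ {a} {b} {t} (≤-pred (subst (_≤ suc t) (+-suc a b) a+b+1≤t+1))
... | inj₁ e = inj₁ e
... | inj₂ (inj₁ e) = inj₂ (inj₁ e)
... | inj₂ (inj₂ (ea , eb , refl)) = inj₂ (inj₂ (ea , eb , refl))

count-onSide : ∀ σ (p r : A → Bool) xs →
  count (λ x → onSide σ (p x) (r x) false) xs ≡ onSide σ (count p xs) (count r xs) 0
count-onSide lower p r xs = refl
count-onSide middle p r xs = refl
count-onSide upper p r xs = count-false xs

sum-tabulate-onSide-side : ∀ X t m → t < m →
  sum (tabulate {n = m} (λ a → onSide (side (toℕ a) t) X ⌊ X /2⌋ 0)) ≡ ⌊ suc t * X /2⌋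
sum-tabulate-onSide-side X zero (suc m) _ = begin
  ⌊ X /2⌋ + sum (tabulate {n = m} (λ _ → 0)) ≡⟨ cong (⌊ X /2⌋ +_) (sum-tabulate-0 m) ⟩
  ⌊ X /2⌋ + 0                                 ≡⟨ +-identityʳ _ ⟩
  ⌊ X /2⌋                                     ≡⟨ cong ⌊_/2⌋ (+-identityʳ X) ⟨
  ⌊ X + 0 /2⌋                                 ∎
sum-tabulate-onSide-side X (suc zero) (suc m) _ = begin
  X + sum (tabulate {n = m} (λ _ → 0)) ≡⟨ cong (X +_) (sum-tabulate-0 m) ⟩
  X + 0                                 ≡⟨ +-identityʳ _ ⟩
  X                                     ≡⟨ n≡⌊n+n/2⌋ X ⟩
  ⌊ X + X /2⌋                           ≡⟨ cong (λ u → ⌊ X + u /2⌋) (+-identityʳ X) ⟨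
  ⌊ X + (X + 0) /2⌋                     ∎
sum-tabulate-onSide-side X (suc (suc t)) (suc m) (s≤s t+1<m) = begin
  X + sum (tabulate {n = m} (λ a → onSide (side (toℕ a) t) X ⌊ X /2⌋ 0))
    ≡⟨ cong (X +_) (sum-tabulate-onSide-side X t m (<⇒≤ t+1<m)) ⟩
  X + ⌊ suc t * X /2⌋
    ≡⟨ ⌊m+m+n/2⌋≡m+⌊n/2⌋ X (suc t * X) ⟨
  ⌊ (X + X) + suc t * X /2⌋
    ≡⟨ cong ⌊_/2⌋ (+-assoc X X (suc t * X)) ⟩
  ⌊ suc (suc (suc t)) * X /2⌋ ∎

SumIntersecting-sym : ∀ {q n s} {x y : Word q n} → SumIntersecting s x y → SumIntersecting s y x
SumIntersecting-sym {s = s} {x} {y} (i , s≤x+y) = i , subst (s ≤_) (+-comm (toℕ (lookupᵛ x i)) _) s≤x+y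

¬SumIntersecting-∷ : ∀ {q n s} {a b} {x y : Word q n} → ¬ SumIntersecting s (a ∷ x) (b ∷ y) →
  toℕ a + toℕ b < s × ¬ SumIntersecting s x y
¬SumIntersecting-∷ ¬si = ≰⇒> (λ s≤a+b → ¬si (zero , s≤a+b)) , λ { (i , s≤) → ¬si (suc i , s≤) }

sumIntersecting? : ∀ {q n} s (x y : Word q n) → Dec (SumIntersecting s x y)
sumIntersecting? s x y = any? (λ i → s ≤? toℕ (lookupᵛ x i) + toℕ (lookupᵛ y i))

allWords : ∀ q n → List (Word q n)
allWords q = vectors (allFin (suc q))

∈-allWords : ∀ {q n} (x : Word q n) → x ∈ allWords q n
∈-allWords = ∈-vectors ∈-allFin

allWords-unique : ∀ q n → Unique (allWords q n)
allWords-unique q = vectors-unique (allFin⁺ (suc q))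

length-allWords : ∀ q n → length (allWords q n) ≡ suc q ^ n
length-allWords q n = trans (length-vectors n) (cong (_^ n) (length-tabulate id))

sum-allFin : ∀ {m} (f : Fin m → ℕ) (g : ℕ → ℕ) → (∀ a → f a ≡ g (toℕ a)) →
  sum (map f (allFin m)) ≡ sum (tabulate {n = m} (g ∘ toℕ))
sum-allFin {m} f g f≗g = cong sum (trans (map-cong f≗g (allFin m)) (map-tabulate {n = m} id (g ∘ toℕ)))

T-not⁻ : ∀ {b} → T (not b) → ¬ T b
T-not⁻ {true} ()

T-not⁺ : ∀ {b} → ¬ T b → T (not b)
T-not⁺ {false} _ = _
T-not⁺ {true} ¬b = ¬b _

-- Here s = suc t: the small letters are 0, …, t and the complement of a letter a is t ∸ a.
module _ (q t : ℕ) (t≤q : t ≤ q) where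

  Small : ∀ {n} → Word q n → Set
  Small = All (λ a → toℕ a < suc t)

  isSmall : ∀ {n} → Word q n → Bool
  isSmall [] = true
  isSmall (a ∷ x) = (toℕ a <ᵇ suc t) ∧ isSmall x

  T-isSmall⇒Small : ∀ {n} {x : Word q n} → T (isSmall x) → Small x
  T-isSmall⇒Small {x = []} _ = []
  T-isSmall⇒Small {x = a ∷ x} small =
    let a<s , small-x = Equivalence.to T-∧ small in <ᵇ⇒< (toℕ a) (suc t) a<s ∷ T-isSmall⇒Small small-x

  Small⇒T-isSmall : ∀ {n} {x : Word q n} → Small x → T (isSmall x)
  Small⇒T-isSmall [] = _
  Small⇒T-isSmall (a<s ∷ small) = Equivalence.from T-∧ (<⇒<ᵇ a<s , Small⇒T-isSmall small)

  ¬Small⇒SumIntersecting : ∀ {n} {x : Word q n} → ¬ Small x → ∀ y → SumIntersecting (suc t) x y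
  ¬Small⇒SumIntersecting {x = []} ¬small [] = ⊥-elim (¬small [])
  ¬Small⇒SumIntersecting {x = a ∷ x} ¬small (b ∷ y) with toℕ a <? suc t
  ... | no a≮s = zero , ≤-trans (≮⇒≥ a≮s) (m≤m+n _ _)
  ... | yes a<s with ¬Small⇒SumIntersecting (λ small-x → ¬small (a<s ∷ small-x)) y
  ...   | i , s≤ = suc i , s≤

  comp : Fin (suc q) → Fin (suc q)
  comp a = fromℕ< (s≤s (≤-trans (m∸n≤m t (toℕ a)) t≤q))

  toℕ-comp : ∀ a → toℕ (comp a) ≡ t ∸ toℕ a
  toℕ-comp a = toℕ-fromℕ< _

  complement : ∀ {n} → Word q n → Word q n
  complement = mapᵛ comp

  complement-small : ∀ {n} (x : Word q n) → Small (complement x)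
  complement-small [] = []
  complement-small (a ∷ x) = subst (_< suc t) (sym (toℕ-comp a)) (s≤s (m∸n≤m t (toℕ a))) ∷ complement-small x

  complement-involutive : ∀ {n} {x : Word q n} → Small x → complement (complement x) ≡ x
  complement-involutive [] = refl
  complement-involutive {x = a ∷ x} (a<s ∷ small) = cong₂ _∷_ comp-comp (complement-involutive small)
    where
    comp-comp : comp (comp a) ≡ a
    comp-comp = toℕ-injective (begin
      toℕ (comp (comp a)) ≡⟨ toℕ-comp (comp a) ⟩
      t ∸ toℕ (comp a)    ≡⟨ cong (t ∸_) (toℕ-comp a) ⟩
      t ∸ (t ∸ toℕ a)     ≡⟨ m∸[m∸n]≡n (≤-pred a<s) ⟩
      toℕ a               ∎)

  complement-¬SumIntersecting : ∀ {n} {x : Word q n} → Small x → ¬ SumIntersecting (suc t) x (complement x)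
  complement-¬SumIntersecting {x = x} small (i , t<sum) = n≮n t (subst (t <_) sum≡t t<sum)
    where
    a = lookupᵛ x i
    sum≡t : toℕ a + toℕ (lookupᵛ (complement x) i) ≡ t
    sum≡t = begin
      toℕ a + toℕ (lookupᵛ (complement x) i) ≡⟨ cong (λ b → toℕ a + toℕ b) (lookup-map i comp x) ⟩
      toℕ a + toℕ (comp a)                   ≡⟨ cong (toℕ a +_) (toℕ-comp a) ⟩
      toℕ a + (t ∸ toℕ a)                    ≡⟨ m+[n∸m]≡n (≤-pred (lookup⁺ small i)) ⟩
      t                                      ∎

  side-comp : ∀ {a} → toℕ a ≤ t → side (toℕ (comp a)) t ≡ opposite (side (toℕ a) t)
  side-comp {a} a≤t = trans (cong (λ u → side u t) (toℕ-comp a)) (side-∸≡opposite a≤t)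

  -- x is small and lexicographically strictly below its complement.
  strictlyLower : ∀ {n} → Word q n → Bool
  strictlyLower [] = false
  strictlyLower (a ∷ x) = onSide (side (toℕ a) t) (isSmall x) (strictlyLower x) false

  strictlyLower⇒Small : ∀ {n} {x : Word q n} → T (strictlyLower x) → Small x
  strictlyLower⇒Small {x = a ∷ x} low with side (toℕ a) t in eq
  ... | lower = s≤s (side≢upper⇒≤ ((λ ()) ∘ trans (sym eq))) ∷ T-isSmall⇒Small low
  ... | middle = s≤s (side≢upper⇒≤ ((λ ()) ∘ trans (sym eq))) ∷ strictlyLower⇒Small low

  strictlyLower-complement : ∀ {n} {x : Word q n} → T (strictlyLower x) → ¬ T (strictlyLower (complement x))
  strictlyLower-complement {x = a ∷ x} low low′ with strictlyLower⇒Small {x = a ∷ x} low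
  ... | a<s ∷ _ rewrite side-comp {a} (≤-pred a<s) with side (toℕ a) t
  ...   | lower = low′
  ...   | middle = strictlyLower-complement {x = x} low low′

  ¬strictlyLower-¬SumIntersecting⇒≡ : ∀ {n} {x y : Word q n} → Small x → Small y →
    ¬ T (strictlyLower x) → ¬ T (strictlyLower y) → ¬ SumIntersecting (suc t) x y → x ≡ y
  ¬strictlyLower-¬SumIntersecting⇒≡ [] [] _ _ _ = refl
  ¬strictlyLower-¬SumIntersecting⇒≡ {x = a ∷ x} {b ∷ y} (_ ∷ sx) (_ ∷ sy) ¬lx ¬ly ¬si
    with ¬SumIntersecting-∷ ¬si
  ... | a+b<s , ¬si′ with side (toℕ a) t | side (toℕ b) t | side-+≤ {toℕ a} {toℕ b} (≤-pred a+b<s)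
  ...   | _ | _ | inj₁ refl = contradiction (Small⇒T-isSmall sx) ¬lx
  ...   | _ | _ | inj₂ (inj₁ refl) = contradiction (Small⇒T-isSmall sy) ¬ly
  ...   | _ | _ | inj₂ (inj₂ (refl , refl , a≡b)) with toℕ-injective a≡b
  ...     | refl = cong (a ∷_) (¬strictlyLower-¬SumIntersecting⇒≡ sx sy ¬lx ¬ly ¬si′)

  canonical : ∀ {n} → Word q n → Word q n
  canonical x = if strictlyLower x then complement x else x

  canonical-¬strictlyLower : ∀ {n} (x : Word q n) → ¬ T (strictlyLower (canonical x))
  canonical-¬strictlyLower x with strictlyLower x in eq
  ... | true = strictlyLower-complement {x = x} (subst T (sym eq) _)
  ... | false = subst (¬_ ∘ T) (sym eq) λ ()

  canonical-≡ : ∀ {n} {x y : Word q n} → canonical x ≡ canonical y →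
    x ≡ y ⊎ (Small x × y ≡ complement x) ⊎ (Small y × x ≡ complement y)
  canonical-≡ {x = x} {y} eq with strictlyLower x in ex | strictlyLower y in ey
  ... | false | false = inj₁ eq
  ... | true | false = inj₂ (inj₁ (strictlyLower⇒Small (subst T (sym ex) _) , sym eq))
  ... | false | true = inj₂ (inj₂ (strictlyLower⇒Small (subst T (sym ey) _) , eq))
  ... | true | true = inj₁ (begin
    x                         ≡⟨ complement-involutive (strictlyLower⇒Small (subst T (sym ex) _)) ⟨
    complement (complement x) ≡⟨ cong complement eq ⟩
    complement (complement y) ≡⟨ complement-involutive (strictlyLower⇒Small (subst T (sym ey) _)) ⟩
    y                         ∎)

  canonical-injectiveOn : ∀ {n} {F : List (Word q n)} → SumIntersectingFamily (suc t) F →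
    ∀ {x y} → x ∈ F → y ∈ F → canonical x ≡ canonical y → x ≡ y
  canonical-injectiveOn family {x} {y} x∈F y∈F eq with ≡-dec Data.Fin._≟_ x y
  ... | yes x≡y = x≡y
  ... | no x≢y with canonical-≡ eq | family x y x∈F y∈F x≢y
  ...   | inj₁ x≡y | _ = x≡y
  ...   | inj₂ (inj₁ (small-x , refl)) | si = contradiction si (complement-¬SumIntersecting small-x)
  ...   | inj₂ (inj₂ (small-y , refl)) | si =
    contradiction (SumIntersecting-sym {x = complement y} {y} si) (complement-¬SumIntersecting small-y)

  extremalFamily : ∀ n → List (Word q n)
  extremalFamily n = filterᵇ (not ∘ strictlyLower) (allWords q n)

  extremalFamily-unique : ∀ n → Unique (extremalFamily n)
  extremalFamily-unique n = filter⁺ (T? ∘ not ∘ strictlyLower) (allWords-unique q n)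

  extremalFamily-sumIntersecting : ∀ n → SumIntersectingFamily (suc t) (extremalFamily n)
  extremalFamily-sumIntersecting n x y x∈G y∈G x≢y
    with all? (λ a → toℕ a <? suc t) x | all? (λ a → toℕ a <? suc t) y
  ... | no ¬small-x | _ = ¬Small⇒SumIntersecting ¬small-x y
  ... | yes _ | no ¬small-y = SumIntersecting-sym {x = y} {x} (¬Small⇒SumIntersecting ¬small-y x)
  ... | yes small-x | yes small-y with sumIntersecting? (suc t) x y
  ...   | yes si = si
  ...   | no ¬si = contradiction (¬strictlyLower-¬SumIntersecting⇒≡ small-x small-y
            (¬lower x∈G) (¬lower y∈G) ¬si) x≢y
    where
    ¬lower : ∀ {z} → z ∈ extremalFamily n → ¬ T (strictlyLower z)
    ¬lower z∈G = T-not⁻ (proj₂ (∈-filter⁻ (T? ∘ not ∘ strictlyLower) {xs = allWords q n} z∈G))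

  count-isSmall : ∀ n → count isSmall (allWords q n) ≡ suc t ^ n
  count-isSmall zero = refl
  count-isSmall (suc n) = begin
    count isSmall (allWords q (suc n))
      ≡⟨ count-vectors-∷ {as = allFin (suc q)} {n} isSmall ⟩
    sum (map (λ a → count (λ x → isSmall (a ∷ x)) (allWords q n)) (allFin (suc q)))
      ≡⟨ sum-allFin {suc q} _ (λ a → if a <ᵇ suc t then suc t ^ n else 0)
           (λ a → trans (count-if (toℕ a <ᵇ suc t) isSmall (allWords q n))
             (cong (if toℕ a <ᵇ suc t then_else 0) (count-isSmall n))) ⟩
    sum (tabulate {n = suc q} (λ a → if toℕ a <ᵇ suc t then suc t ^ n else 0))
      ≡⟨ sum-tabulate-<ᵇ (suc t ^ n) (suc t) (suc q) (s≤s t≤q) ⟩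
    suc t ^ suc n ∎

  count-strictlyLower : ∀ n → count strictlyLower (allWords q n) ≡ ⌊ suc t ^ n /2⌋
  count-strictlyLower zero = refl
  count-strictlyLower (suc n) = begin
    count strictlyLower (allWords q (suc n))
      ≡⟨ count-vectors-∷ {as = allFin (suc q)} {n} strictlyLower ⟩
    sum (map (λ a → count (λ x → strictlyLower (a ∷ x)) (allWords q n)) (allFin (suc q)))
      ≡⟨ sum-allFin {suc q} _ (λ a → onSide (side a t) (suc t ^ n) ⌊ suc t ^ n /2⌋ 0)
           (λ a → trans (count-onSide (side (toℕ a) t) isSmall strictlyLower (allWords q n))
             (cong₂ (λ X Y → onSide (side (toℕ a) t) X Y 0) (count-isSmall n) (count-strictlyLower n))) ⟩
    sum (tabulate {n = suc q} (λ a → onSide (side (toℕ a) t) (suc t ^ n) ⌊ suc t ^ n /2⌋ 0))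
      ≡⟨ sum-tabulate-onSide-side (suc t ^ n) t (suc q) (s≤s t≤q) ⟩
    ⌊ suc t ^ suc n /2⌋ ∎

  length-extremalFamily : ∀ n → length (extremalFamily n) ≡ suc q ^ n ∸ ⌊ suc t ^ n /2⌋
  length-extremalFamily n = begin
    count (not ∘ strictlyLower) words
      ≡⟨ m+n∸m≡n lowerCount _ ⟨
    (lowerCount + count (not ∘ strictlyLower) words) ∸ lowerCount
      ≡⟨ cong (_∸ lowerCount) (count+count-not strictlyLower words) ⟩
    length words ∸ lowerCount
      ≡⟨ cong₂ _∸_ (length-allWords q n) (count-strictlyLower n) ⟩
    suc q ^ n ∸ ⌊ suc t ^ n /2⌋ ∎
    where
    words = allWords q n
    lowerCount = count strictlyLower words

  sumIntersecting-length≤ : ∀ {n} (F : List (Word q n)) → Unique F → SumIntersectingFamily (suc t) F →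
    length F ≤ length (extremalFamily n)
  sumIntersecting-length≤ {n} F unique family = length-≤-count canonical (not ∘ strictlyLower) unique
    (canonical-injectiveOn family) (λ {x} _ → ∈-allWords (canonical x))
    (λ {x} _ → T-not⁺ (canonical-¬strictlyLower x))

corollary2p2 : (n q s : ℕ) → n ≥ 1 → q ≥ 1 → s ≥ 1 → q ≥ s →
    ((F : List (Word q n)) → Unique F → SumIntersectingFamily s F →
    length F ≤ (suc q ^ n ∸ s ^ n) + ⌈ s ^ n /2⌉)
    × Σ (List (Word q n)) (λ F → Unique F × SumIntersectingFamily s F ×
    length F ≡ (suc q ^ n ∸ s ^ n) + ⌈ s ^ n /2⌉)
corollary2p2 n q (suc t) _ _ _ s≤q =
    (λ F unique family → subst (length F ≤_) size≡bound (sumIntersecting-length≤ q t t≤q F unique family))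
  , extremalFamily q t t≤q n
  , extremalFamily-unique q t t≤q n
  , extremalFamily-sumIntersecting q t t≤q n
  , size≡bound
  where
  t≤q : t ≤ q
  t≤q = <⇒≤ s≤q
  size≡bound : length (extremalFamily q t t≤q n) ≡ (suc q ^ n ∸ suc t ^ n) + ⌈ suc t ^ n /2⌉
  size≡bound = trans (length-extremalFamily q t t≤q n) (sym ([m∸n]+⌈n/2⌉≡m∸⌊n/2⌋ (^-monoˡ-≤ n (s≤s t≤q))))
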